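{- Let $\Gamma$ be a finite-type Dynkin diagram with vertices indexed $1,\dots,n$ and Cartan matrix $\mathsf{C}$, and let $b_i:=\sum_{j=1}^n (\mathsf{C}^{ -1})_{i,j}$ be the sum of the $i$-th row of $\mathsf{C}^{ -1}$. Let $F$ be a positive integral frieze of type $\Gamma$, and let $p\geq1$ be an integer such that $F_{i,k+p}=F_{i,k}$ for all $i,k$. Set $a_i(F):=\frac{1}{p}\sum_{k=1}^p\log_2(F_{i,k})$. Then for all $i\in\{1,\dots,n\}$ and $k\in\mathbb{Z}$, $a_i(F)\leq b_i$ and $F_{i,k}\leq 2^{p b_i}$.
   Context: $\Gamma$ is a finite-type (not necessarily simply-laced) Dynkin diagram with vertices indexed $1,\dots,n$, and $\mathsf{C}=(\mathsf{C}_{i,j})$ is its Cartan matrix (so $\mathsf{C}_{i,i}=2$ and $\mathsf{C}_{i,j}\le 0$ for $i\ne j$); it is invertible. A positive integral frieze of type $\Gamma$ is a function $F:\{1,\dots,n\}\times\mathbb{Z}\to\mathbb{Z}_{\geq 1}$, $(i,k)\mapsto F_{i,k}$, satisfying the mesh relations: for every $(i,k)\in\{1,\dots,n\}\times\mathbb{Z}$, \[ F_{i,k}F_{i,k+1}=1+\prod_{j<i}F_{j,k}^{ -\mathsf{C}_{i,j}}\prod_{j>i}F_{j,k+1}^{ -\mathsf{C}_{i,j}}. \] (It is known that every such frieze is periodic in $k$ for some period $p$.) -}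

module Defs where

open import Data.Nat using (ℕ; zero; suc; _+_; _*_; _∸_; _^_; _≤_; _<ᵇ_)
open import Data.Nat.Properties using (_≟_)
open import Data.Bool using (Bool; true; false; if_then_else_)
open import Data.Fin using (Fin; toℕ; _<?_)
import Data.Fin as F
open import Data.Fin.Permutation using (Permutation′; _⟨$⟩ʳ_)
open import Data.Integer as ℤ using (ℤ; +_; -_; ∣_∣)
open import Data.List using (List; []; _∷_; _++_)
open import Data.Product using (_×_; _,_)
open import Relation.Nullary using (yes; no)
open import Relation.Binary.PropositionalEquality using (_≡_)

-- Connected finite-type Dynkin diagrams (Bourbaki labelling, 0-based)

data Dynkin : ℕ → Set where
  A  : (m : ℕ) → Dynkin (suc m)
  B  : (m : ℕ) → Dynkin (2 + m)
  C  : (m : ℕ) → Dynkin (2 + m)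
  D  : (m : ℕ) → Dynkin (4 + m)
  E6 : Dynkin 6
  E7 : Dynkin 7
  E8 : Dynkin 8
  F4 : Dynkin 4
  G2 : Dynkin 2

-- A directed edge (a , b , w) records the Cartan entry C_{a,b} = - w.
Edge : Set
Edge = ℕ × ℕ × ℕ

simple : ℕ → ℕ → List Edge
simple a b = (a , b , 1) ∷ (b , a , 1) ∷ []

chainFrom : ℕ → ℕ → List Edge
chainFrom s zero = []
chainFrom s (suc len) = simple s (suc s) ++ chainFrom (suc s) len

edges : ∀ {n} → Dynkin n → List Edge
edges (A m) = chainFrom 0 m
edges (B m) = chainFrom 0 m ++ ((m , suc m , 2) ∷ (suc m , m , 1) ∷ [])
edges (C m) = chainFrom 0 m ++ ((m , suc m , 1) ∷ (suc m , m , 2) ∷ [])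
edges (D m) = chainFrom 0 (2 + m) ++ simple (1 + m) (3 + m)
edges E6 = chainFrom 2 3 ++ simple 0 2 ++ simple 1 3
edges E7 = chainFrom 2 4 ++ simple 0 2 ++ simple 1 3
edges E8 = chainFrom 2 5 ++ simple 0 2 ++ simple 1 3
edges F4 = simple 0 1 ++ ((1 , 2 , 2) ∷ (2 , 1 , 1) ∷ []) ++ simple 2 3
edges G2 = (0 , 1 , 1) ∷ (1 , 0 , 3) ∷ []

edgeWeight : List Edge → ℕ → ℕ → ℕ
edgeWeight [] i j = 0
edgeWeight ((a , b , w) ∷ es) i j with a ≟ i | b ≟ j
... | yes _ | yes _ = w + edgeWeight es i j
... | _     | _     = edgeWeight es i j

cartan : ∀ {n} → Dynkin n → Fin n → Fin n → ℤ
cartan Γ i j with toℕ i ≟ toℕ j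
... | yes _ = + 2
... | no  _ = - (+ edgeWeight (edges Γ) (toℕ i) (toℕ j))

cartanRelabel : ∀ {n} → Dynkin n → Permutation′ n → Fin n → Fin n → ℤ
cartanRelabel Γ σ i j = cartan Γ (σ ⟨$⟩ʳ i) (σ ⟨$⟩ʳ j)

prodFin : ∀ {n} → (Fin n → ℕ) → ℕ
prodFin {zero}  f = 1
prodFin {suc n} f = f F.zero * prodFin (λ j → f (F.suc j))

prodUpTo : ℕ → (ℕ → ℕ) → ℕ
prodUpTo zero    g = 1
prodUpTo (suc p) g = prodUpTo p g * g (suc p)

-- Mesh relation at (i , k):
-- F i k * F i (k+1) = 1 + ∏_{j<i} F j k ^ (-C i j) * ∏_{j>i} F j (k+1) ^ (-C i j)
-- (for j ≠ i, C i j ≤ 0, so -C i j = ∣ C i j ∣).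
MeshAt : ∀ {n} → (Fin n → Fin n → ℤ) → (Fin n → ℤ → ℕ) → Fin n → ℤ → Set
MeshAt {n} Cm F i k =
  F i k * F i (k ℤ.+ + 1) ≡
    1 + prodFin (λ j → lowerFactor j) * prodFin (λ j → upperFactor j)
  where
    lowerFactor : Fin n → ℕ
    lowerFactor j with j <? i
    ... | yes _ = F j k ^ ∣ Cm i j ∣
    ... | no  _ = 1
    upperFactor : Fin n → ℕ
    upperFactor j with i <? j
    ... | yes _ = F j (k ℤ.+ + 1) ^ ∣ Cm i j ∣
    ... | no  _ = 1

record IsPositiveIntegralFrieze {n} (Cm : Fin n → Fin n → ℤ) (F : Fin n → ℤ → ℕ) : Set where
  field
    positive : ∀ i k → 1 ≤ F i k
    mesh     : ∀ i k → MeshAt Cm F i k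

sumFinℤ : ∀ {n} → (Fin n → ℤ) → ℤ
sumFinℤ {zero}  f = + 0
sumFinℤ {suc n} f = f F.zero ℤ.+ sumFinℤ (λ j → f (F.suc j))

-- Let P i be the product of F i k over one period. Multiplying the mesh relations over a
-- period gives  ∏ⱼ P j ^ c i j ≤ P i ² ≤ 2 ^ p ∏ⱼ P j ^ c i j,  where c i j = - C i j off the
-- diagonal: the vector log P satisfies 0 ≤ (C log P)ᵢ ≤ p. Split d b = b⁺ - b⁻ with disjoint
-- supports. At an index maximising b⁻ i / log P i the lower bound forbids b⁺ i = 0, so
-- b⁻ vanishes there and hence everywhere. At an index maximising log P i / b⁺ i the upper
-- bound gives d log P i ≤ p b⁺ i, and maximality carries this to every index. Finally
-- every F i k is a factor of P i.

module Submission where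

open import Defs
open import Data.Nat
open import Data.Nat.Properties
open import Data.Integer using (ℤ; +_; -_; -[1+_]; _-_; ∣_∣; +≤+)
  renaming (_≤_ to _≤ℤ_; _*_ to _*ℤ_; _+_ to _+ℤ_)
import Data.Integer.Properties as ℤ
import Data.Integer.DivMod as DivMod
open import Data.Integer.Tactic.RingSolver using (solve-∀)
open import Algebra.Properties.CommutativeMonoid.Sum +-0-commutativeMonoid
  using (sum; sum-remove; sum-cong-≗; sum-replicate-zero; ∑-distrib-+)
open import Data.Vec.Functional using (removeAt; replicate)
open import Data.Fin as Fin using (Fin)
import Data.Fin.Properties as Fin
open import Data.Fin.Permutation using (Permutation′; _⟨$⟩ʳ_; _⟨$⟩ˡ_; inverseˡ)
open import Data.Product using (∃-syntax; _×_; _,_; proj₁; proj₂)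
open import Data.Sum using (_⊎_; inj₁; inj₂; [_,_]′)
open import Function using (id; _∘_; flip)
open import Relation.Binary.Core using (Rel)
open import Relation.Binary.Definitions using (Total; Transitive)
open import Relation.Nullary using (yes; no; contradiction)
open import Relation.Binary.PropositionalEquality

^-distribʳ-* : ∀ m n o → (m * n) ^ o ≡ m ^ o * n ^ o
^-distribʳ-* m n zero    = refl
^-distribʳ-* m n (suc o) = begin
  m * n * (m * n) ^ o       ≡⟨ cong (m * n *_) (^-distribʳ-* m n o) ⟩
  m * n * (m ^ o * n ^ o)   ≡⟨ [m*n]*[o*p]≡[m*o]*[n*p] m n (m ^ o) (n ^ o) ⟩
  m * m ^ o * (n * n ^ o)   ∎
  where open ≡-Reasoning

[m^n]^o≡[m^o]^n : ∀ m n o → (m ^ n) ^ o ≡ (m ^ o) ^ n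
[m^n]^o≡[m^o]^n m n o = begin
  (m ^ n) ^ o  ≡⟨ ^-*-assoc m n o ⟩
  m ^ (n * o)  ≡⟨ cong (m ^_) (*-comm n o) ⟩
  m ^ (o * n)  ≡⟨ ^-*-assoc m o n ⟨
  (m ^ o) ^ n  ∎
  where open ≡-Reasoning

^-cancelʳ-≤ : ∀ {m n} o .{{_ : NonZero o}} → m ^ o ≤ n ^ o → m ≤ n
^-cancelʳ-≤ {m} {n} o mᵒ≤nᵒ with m ≤? n
... | yes m≤n = m≤n
... | no  m≰n = contradiction mᵒ≤nᵒ (<⇒≱ (^-monoˡ-< o (≰⇒> m≰n)))

m^n≤1⇒n≡0 : ∀ {m} n → 1 < m → m ^ n ≤ 1 → n ≡ 0
m^n≤1⇒n≡0 zero    1<m mⁿ≤1 = refl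
m^n≤1⇒n≡0 {m} (suc n) 1<m mⁿ≤1 = contradiction mⁿ≤1 (<⇒≱ (^-monoʳ-< m 1<m (z<s {n})))

1+m≤2*m : ∀ m .{{_ : NonZero m}} → 1 + m ≤ 2 * m
1+m≤2*m m = subst (1 + m ≤_) (cong (_+_ m) (sym (+-identityʳ m))) (+-monoˡ-≤ m (>-nonZero⁻¹ m))

prodFin-cong : ∀ {n} {f g : Fin n → ℕ} → (∀ j → f j ≡ g j) → prodFin f ≡ prodFin g
prodFin-cong {zero}  f≗g = refl
prodFin-cong {suc n} f≗g = cong₂ _*_ (f≗g Fin.zero) (prodFin-cong (f≗g ∘ Fin.suc))

prodFin-mono-≤ : ∀ {n} {f g : Fin n → ℕ} → (∀ j → f j ≤ g j) → prodFin f ≤ prodFin g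
prodFin-mono-≤ {zero}  f≤g = ≤-refl
prodFin-mono-≤ {suc n} f≤g = *-mono-≤ (f≤g Fin.zero) (prodFin-mono-≤ (f≤g ∘ Fin.suc))

prodFin-distrib-* : ∀ {n} (f g : Fin n → ℕ) → prodFin (λ j → f j * g j) ≡ prodFin f * prodFin g
prodFin-distrib-* {zero}  f g = refl
prodFin-distrib-* {suc n} f g = begin
  f₀ * g₀ * prodFin (λ j → f (Fin.suc j) * g (Fin.suc j))
    ≡⟨ cong (f₀ * g₀ *_) (prodFin-distrib-* (f ∘ Fin.suc) (g ∘ Fin.suc)) ⟩
  f₀ * g₀ * (prodFin (f ∘ Fin.suc) * prodFin (g ∘ Fin.suc))
    ≡⟨ [m*n]*[o*p]≡[m*o]*[n*p] f₀ g₀ _ _ ⟩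
  f₀ * prodFin (f ∘ Fin.suc) * (g₀ * prodFin (g ∘ Fin.suc)) ∎
  where
  open ≡-Reasoning
  f₀ = f Fin.zero
  g₀ = g Fin.zero

prodFin-^ : ∀ {n} (f : Fin n → ℕ) o → prodFin f ^ o ≡ prodFin (λ j → f j ^ o)
prodFin-^ {zero}  f o = ^-zeroˡ o
prodFin-^ {suc n} f o = begin
  (f Fin.zero * prodFin (f ∘ Fin.suc)) ^ o
    ≡⟨ ^-distribʳ-* (f Fin.zero) _ o ⟩
  f Fin.zero ^ o * prodFin (f ∘ Fin.suc) ^ o
    ≡⟨ cong (f Fin.zero ^ o *_) (prodFin-^ (f ∘ Fin.suc) o) ⟩
  f Fin.zero ^ o * prodFin (λ j → f (Fin.suc j) ^ o) ∎
  where open ≡-Reasoning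

^-distribˡ-sum : ∀ {n} m (f : Fin n → ℕ) → m ^ sum f ≡ prodFin (λ j → m ^ f j)
^-distribˡ-sum {zero}  m f = refl
^-distribˡ-sum {suc n} m f = begin
  m ^ (f Fin.zero + sum (f ∘ Fin.suc))     ≡⟨ ^-distribˡ-+-* m (f Fin.zero) _ ⟩
  m ^ f Fin.zero * m ^ sum (f ∘ Fin.suc)   ≡⟨ cong (m ^ f Fin.zero *_) (^-distribˡ-sum m (f ∘ Fin.suc)) ⟩
  m ^ f Fin.zero * prodFin (λ j → m ^ f (Fin.suc j)) ∎
  where open ≡-Reasoning

prodFin-nonZero : ∀ {n} (f : Fin n → ℕ) → (∀ j → NonZero (f j)) → NonZero (prodFin f)
prodFin-nonZero {zero}  f nz = _
prodFin-nonZero {suc n} f nz =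
  m*n≢0 (f Fin.zero) _ {{nz Fin.zero}} {{prodFin-nonZero (f ∘ Fin.suc) (nz ∘ Fin.suc)}}

sum-single : ∀ {n} (i : Fin n) (f : Fin n → ℕ) → (∀ j → j ≢ i → f j ≡ 0) → sum f ≡ f i
sum-single {suc n} i f vanish = begin
  sum f                               ≡⟨ sum-remove f ⟩
  f i + sum (removeAt f i)            ≡⟨ cong (_+_ (f i)) (sum-cong-≗ (λ j → vanish _ (Fin.punchInᵢ≢i i j))) ⟩
  f i + sum (replicate n 0)           ≡⟨ cong (_+_ (f i)) (sum-replicate-zero n) ⟩
  f i + 0                             ≡⟨ +-identityʳ (f i) ⟩
  f i                                 ∎
  where open ≡-Reasoning

prodUpTo-cong : ∀ p {f g : ℕ → ℕ} → (∀ k → f k ≡ g k) → prodUpTo p f ≡ prodUpTo p g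
prodUpTo-cong zero    f≗g = refl
prodUpTo-cong (suc p) f≗g = cong₂ _*_ (prodUpTo-cong p f≗g) (f≗g (suc p))

prodUpTo-mono-≤ : ∀ p {f g : ℕ → ℕ} → (∀ k → f k ≤ g k) → prodUpTo p f ≤ prodUpTo p g
prodUpTo-mono-≤ zero    f≤g = ≤-refl
prodUpTo-mono-≤ (suc p) f≤g = *-mono-≤ (prodUpTo-mono-≤ p f≤g) (f≤g (suc p))

prodUpTo-distrib-* : ∀ p (f g : ℕ → ℕ) →
  prodUpTo p (λ k → f k * g k) ≡ prodUpTo p f * prodUpTo p g
prodUpTo-distrib-* zero    f g = refl
prodUpTo-distrib-* (suc p) f g = begin
  prodUpTo p (λ k → f k * g k) * (f (suc p) * g (suc p))
    ≡⟨ cong (_* (f (suc p) * g (suc p))) (prodUpTo-distrib-* p f g) ⟩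
  prodUpTo p f * prodUpTo p g * (f (suc p) * g (suc p))
    ≡⟨ [m*n]*[o*p]≡[m*o]*[n*p] (prodUpTo p f) _ _ _ ⟩
  prodUpTo p f * f (suc p) * (prodUpTo p g * g (suc p)) ∎
  where open ≡-Reasoning

prodUpTo-^ : ∀ p (f : ℕ → ℕ) o → prodUpTo p (λ k → f k ^ o) ≡ prodUpTo p f ^ o
prodUpTo-^ zero    f o = sym (^-zeroˡ o)
prodUpTo-^ (suc p) f o = begin
  prodUpTo p (λ k → f k ^ o) * f (suc p) ^ o  ≡⟨ cong (_* f (suc p) ^ o) (prodUpTo-^ p f o) ⟩
  prodUpTo p f ^ o * f (suc p) ^ o            ≡⟨ ^-distribʳ-* (prodUpTo p f) (f (suc p)) o ⟨
  (prodUpTo p f * f (suc p)) ^ o              ∎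
  where open ≡-Reasoning

prodUpTo-const : ∀ p m → prodUpTo p (λ _ → m) ≡ m ^ p
prodUpTo-const zero    m = refl
prodUpTo-const (suc p) m = trans (cong (_* m) (prodUpTo-const p m)) (*-comm (m ^ p) m)

prodUpTo-prodFin : ∀ {n} p (f : Fin n → ℕ → ℕ) →
  prodUpTo p (λ k → prodFin (λ j → f j k)) ≡ prodFin (λ j → prodUpTo p (f j))
prodUpTo-prodFin {n} zero    f = sym (prodFin-const-1 n)
  where
  prodFin-const-1 : ∀ n → prodFin {n} (λ _ → 1) ≡ 1
  prodFin-const-1 zero    = refl
  prodFin-const-1 (suc n) = trans (+-identityʳ _) (prodFin-const-1 n)
prodUpTo-prodFin (suc p) f = begin
  prodUpTo p (λ k → prodFin (λ j → f j k)) * prodFin (λ j → f j (suc p))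
    ≡⟨ cong (_* prodFin (λ j → f j (suc p))) (prodUpTo-prodFin p f) ⟩
  prodFin (λ j → prodUpTo p (f j)) * prodFin (λ j → f j (suc p))
    ≡⟨ prodFin-distrib-* (λ j → prodUpTo p (f j)) (λ j → f j (suc p)) ⟨
  prodFin (λ j → prodUpTo p (f j) * f j (suc p)) ∎
  where open ≡-Reasoning

prodUpTo-suc : ∀ p (g : ℕ → ℕ) → prodUpTo (suc p) g ≡ g 1 * prodUpTo p (g ∘ suc)
prodUpTo-suc zero    g = *-comm 1 (g 1)
prodUpTo-suc (suc p) g = begin
  prodUpTo (suc p) g * g (2 + p)           ≡⟨ cong (_* g (2 + p)) (prodUpTo-suc p g) ⟩
  g 1 * prodUpTo p (g ∘ suc) * g (2 + p)   ≡⟨ *-assoc (g 1) _ _ ⟩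
  g 1 * prodUpTo (suc p) (g ∘ suc)         ∎
  where open ≡-Reasoning

prodUpTo-rotate : ∀ p (g : ℕ → ℕ) .{{_ : NonZero (g 1)}} → g (suc p) ≡ g 1 →
  prodUpTo p (g ∘ suc) ≡ prodUpTo p g
prodUpTo-rotate p g gₚ₊₁≡g₁ = *-cancelˡ-≡ _ _ (g 1) (begin
  g 1 * prodUpTo p (g ∘ suc)  ≡⟨ prodUpTo-suc p g ⟨
  prodUpTo p g * g (suc p)    ≡⟨ cong (prodUpTo p g *_) gₚ₊₁≡g₁ ⟩
  prodUpTo p g * g 1          ≡⟨ *-comm _ (g 1) ⟩
  g 1 * prodUpTo p g          ∎)
  where open ≡-Reasoning

prodUpTo-nonZero : ∀ p (g : ℕ → ℕ) → (∀ k → NonZero (g k)) → NonZero (prodUpTo p g)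
prodUpTo-nonZero zero    g nz = _
prodUpTo-nonZero (suc p) g nz = m*n≢0 _ _ {{prodUpTo-nonZero p g nz}} {{nz (suc p)}}

factor≤prodUpTo : ∀ {p r} (g : ℕ → ℕ) → (∀ k → NonZero (g k)) → r < p → g (suc r) ≤ prodUpTo p g
factor≤prodUpTo {suc p} {r} g nz r<1+p with r ≟ p
... | yes refl = m≤n*m (g (suc r)) (prodUpTo r g) {{prodUpTo-nonZero r g nz}}
... | no  r≢p  = ≤-trans (factor≤prodUpTo g nz (≤∧≢⇒< (≤-pred r<1+p) r≢p))
                         (m≤m*n _ (g (suc p)) {{nz (suc p)}})

prodUpTo-1 : ∀ p → prodUpTo p (λ _ → 1) ≡ 1
prodUpTo-1 p = trans (prodUpTo-const p 1) (^-zeroˡ p)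

∃-greatest : ∀ {n ℓ} (_≼_ : Rel (Fin n) ℓ) → Total _≼_ → Transitive _≼_ → Fin n →
  ∃[ i ] ∀ j → j ≼ i
∃-greatest {suc zero} _≼_ total ≼-trans _ = Fin.zero , λ { Fin.zero → [ id , id ]′ (total Fin.zero Fin.zero) }
∃-greatest {suc (suc m)} _≼_ total ≼-trans _
  with ∃-greatest (λ j k → Fin.suc j ≼ Fin.suc k) (λ j k → total _ _) ≼-trans Fin.zero
... | i , j≼i with total Fin.zero (Fin.suc i)
...   | inj₁ 0≼i = Fin.suc i , λ { Fin.zero → 0≼i ; (Fin.suc j) → j≼i j }
...   | inj₂ i≼0 = Fin.zero , λ { Fin.zero → [ id , id ]′ (total Fin.zero Fin.zero)
                               ; (Fin.suc j) → ≼-trans (j≼i j) i≼0 }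

infix 10 _⁺ _⁻

_⁺ : ℤ → ℕ
(+ n)    ⁺ = n
-[1+ n ] ⁺ = 0

_⁻ : ℤ → ℕ
(+ n)    ⁻ = 0
-[1+ n ] ⁻ = suc n

x≡x⁺-x⁻ : ∀ x → x ≡ + x ⁺ - + x ⁻
x≡x⁺-x⁻ (+ n)    = sym (ℤ.+-identityʳ (+ n))
x≡x⁺-x⁻ -[1+ n ] = refl

pos-*+* : ∀ a b c d → + (a * b + c * d) ≡ + a *ℤ + b +ℤ + c *ℤ + d
pos-*+* a b c d = trans (ℤ.pos-+ (a * b) (c * d)) (cong₂ _+ℤ_ (ℤ.pos-* a b) (ℤ.pos-* c d))

split-⁺⁻-* : ∀ m x → + (m ⁺ * x ⁺ + m ⁻ * x ⁻) ≡ m *ℤ x +ℤ + (m ⁻ * x ⁺ + m ⁺ * x ⁻)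
split-⁺⁻-* m x = begin
  + (m ⁺ * x ⁺ + m ⁻ * x ⁻)                      ≡⟨ pos-*+* (m ⁺) (x ⁺) (m ⁻) (x ⁻) ⟩
  m⁺ *ℤ x⁺ +ℤ m⁻ *ℤ x⁻                           ≡⟨ expand m⁺ m⁻ x⁺ x⁻ ⟩
  (m⁺ - m⁻) *ℤ (x⁺ - x⁻) +ℤ (m⁻ *ℤ x⁺ +ℤ m⁺ *ℤ x⁻) ≡⟨ cong₂ (λ y z → y *ℤ z +ℤ (m⁻ *ℤ x⁺ +ℤ m⁺ *ℤ x⁻)) (x≡x⁺-x⁻ m) (x≡x⁺-x⁻ x) ⟨
  m *ℤ x +ℤ (m⁻ *ℤ x⁺ +ℤ m⁺ *ℤ x⁻)               ≡⟨ cong (m *ℤ x +ℤ_) (pos-*+* (m ⁻) (x ⁺) (m ⁺) (x ⁻)) ⟨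
  m *ℤ x +ℤ + (m ⁻ * x ⁺ + m ⁺ * x ⁻)            ∎
  where
  open ≡-Reasoning
  m⁺ = + m ⁺
  m⁻ = + m ⁻
  x⁺ = + x ⁺
  x⁻ = + x ⁻
  expand : ∀ a b c d → a *ℤ c +ℤ b *ℤ d ≡ (a - b) *ℤ (c - d) +ℤ (b *ℤ c +ℤ a *ℤ d)
  expand = solve-∀

sumFinℤ-cong : ∀ {n} {f g : Fin n → ℤ} → (∀ j → f j ≡ g j) → sumFinℤ f ≡ sumFinℤ g
sumFinℤ-cong {zero}  f≗g = refl
sumFinℤ-cong {suc n} f≗g = cong₂ _+ℤ_ (f≗g Fin.zero) (sumFinℤ-cong (f≗g ∘ Fin.suc))

sumFinℤ-distrib-+ : ∀ {n} (f g : Fin n → ℤ) → sumFinℤ (λ j → f j +ℤ g j) ≡ sumFinℤ f +ℤ sumFinℤ g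
sumFinℤ-distrib-+ {zero}  f g = refl
sumFinℤ-distrib-+ {suc n} f g = begin
  f₀ +ℤ g₀ +ℤ sumFinℤ (λ j → f (Fin.suc j) +ℤ g (Fin.suc j))
    ≡⟨ cong (f₀ +ℤ g₀ +ℤ_) (sumFinℤ-distrib-+ (f ∘ Fin.suc) (g ∘ Fin.suc)) ⟩
  f₀ +ℤ g₀ +ℤ (sumFinℤ (f ∘ Fin.suc) +ℤ sumFinℤ (g ∘ Fin.suc))
    ≡⟨ interchange f₀ g₀ _ _ ⟩
  f₀ +ℤ sumFinℤ (f ∘ Fin.suc) +ℤ (g₀ +ℤ sumFinℤ (g ∘ Fin.suc)) ∎
  where
  open ≡-Reasoning
  f₀ = f Fin.zero
  g₀ = g Fin.zero
  interchange : ∀ a b c d → a +ℤ b +ℤ (c +ℤ d) ≡ a +ℤ c +ℤ (b +ℤ d)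
  interchange = solve-∀

sumFinℤ-pos : ∀ {n} (f : Fin n → ℕ) → sumFinℤ (λ j → + f j) ≡ + sum f
sumFinℤ-pos {zero}  f = refl
sumFinℤ-pos {suc n} f = begin
  + f Fin.zero +ℤ sumFinℤ (λ j → + f (Fin.suc j))  ≡⟨ cong (+ f Fin.zero +ℤ_) (sumFinℤ-pos (f ∘ Fin.suc)) ⟩
  + f Fin.zero +ℤ + sum (f ∘ Fin.suc)              ≡⟨ ℤ.pos-+ (f Fin.zero) _ ⟨
  + sum f                                          ∎
  where open ≡-Reasoning

split-⁺⁻-sum : ∀ {n} (M : Fin n → Fin n → ℤ) (x : Fin n → ℤ) (d : ℕ) i →
  sumFinℤ (λ j → M i j *ℤ x j) ≡ + d →
  sum (λ j → M i j ⁺ * x j ⁺ + M i j ⁻ * x j ⁻) ≡ d + sum (λ j → M i j ⁻ * x j ⁺ + M i j ⁺ * x j ⁻)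
split-⁺⁻-sum M x d i Mx≡d = ℤ.+-injective (begin
  + sum L                                       ≡⟨ sumFinℤ-pos L ⟨
  sumFinℤ (λ j → + L j)                         ≡⟨ sumFinℤ-cong (λ j → split-⁺⁻-* (M i j) (x j)) ⟩
  sumFinℤ (λ j → M i j *ℤ x j +ℤ + R j)         ≡⟨ sumFinℤ-distrib-+ (λ j → M i j *ℤ x j) (λ j → + R j) ⟩
  sumFinℤ (λ j → M i j *ℤ x j) +ℤ sumFinℤ (λ j → + R j) ≡⟨ cong₂ _+ℤ_ Mx≡d (sumFinℤ-pos R) ⟩
  + d +ℤ + sum R                                ≡⟨ ℤ.pos-+ d (sum R) ⟨
  + (d + sum R)                                 ∎)
  where
  open ≡-Reasoning
  L R : Fin _ → ℕ
  L j = M i j ⁺ * x j ⁺ + M i j ⁻ * x j ⁻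
  R j = M i j ⁻ * x j ⁺ + M i j ⁺ * x j ⁻

⁻≡0⊎⁺≡0 : ∀ x → x ⁻ ≡ 0 ⊎ x ⁺ ≡ 0
⁻≡0⊎⁺≡0 (+ n)    = inj₁ refl
⁻≡0⊎⁺≡0 -[1+ n ] = inj₂ refl

⁻≡0⇒x≡+x⁺ : ∀ x → x ⁻ ≡ 0 → x ≡ + x ⁺
⁻≡0⇒x≡+x⁺ (+ n) _ = refl

nonPositive⇒⁺≡0 : ∀ {x} → x ≤ℤ + 0 → x ⁺ ≡ 0
nonPositive⇒⁺≡0 {+ zero}   _ = refl
nonPositive⇒⁺≡0 { -[1+ n ]} _ = refl
nonPositive⇒⁺≡0 {+ suc n}  (+≤+ ())

nonPositive⇒⁻≡∣x∣ : ∀ {x} → x ≤ℤ + 0 → x ⁻ ≡ ∣ x ∣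
nonPositive⇒⁻≡∣x∣ {+ zero}   _ = refl
nonPositive⇒⁻≡∣x∣ { -[1+ n ]} _ = refl
nonPositive⇒⁻≡∣x∣ {+ suc n}  (+≤+ ())

neighbourProduct : ∀ {n} → (Fin n → Fin n → ℕ) → (Fin n → ℕ) → Fin n → ℕ
neighbourProduct c P i = prodFin (λ j → P j ^ c i j)

weightedSum : ∀ {n} → (Fin n → Fin n → ℕ) → (Fin n → ℕ) → Fin n → ℕ
weightedSum c s i = sum (λ j → c i j * s j)

-- (2 I - c) (b - a) = d (1, …, 1), with the subtracted terms moved to the other side.
Balanced : ∀ {n} → (Fin n → Fin n → ℕ) → ℕ → (Fin n → ℕ) → (Fin n → ℕ) → Set
Balanced c d a b = ∀ i → 2 * b i + weightedSum c a i ≡ d + (weightedSum c b i + 2 * a i)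

weightedSum-vanishes : ∀ {n} (c : Fin n → Fin n → ℕ) {s : Fin n → ℕ} → (∀ j → s j ≡ 0) →
  ∀ i → weightedSum c s i ≡ 0
weightedSum-vanishes {n} c s≡0 i = trans
  (sum-cong-≗ (λ j → trans (cong (c i j *_) (s≡0 j)) (*-zeroʳ (c i j))))
  (sum-replicate-zero n)

record IsCartanLike {n} (M : Fin n → Fin n → ℤ) : Set where
  field
    diagonal    : ∀ i → M i i ≡ + 2
    offDiagonal : ∀ i j → i ≢ j → M i j ≤ℤ + 0

  ⁻-diagonal : ∀ i → M i i ⁻ ≡ 0
  ⁻-diagonal i = cong _⁻ (diagonal i)

  ⁻-offDiagonal : ∀ i j → i ≢ j → M i j ⁻ ≡ ∣ M i j ∣
  ⁻-offDiagonal i j i≢j = nonPositive⇒⁻≡∣x∣ (offDiagonal i j i≢j)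

  sum-⁺ : ∀ i (s : Fin n → ℕ) → sum (λ j → M i j ⁺ * s j) ≡ 2 * s i
  sum-⁺ i s = trans
    (sum-single i (λ j → M i j ⁺ * s j)
      (λ j j≢i → cong (_* s j) (nonPositive⇒⁺≡0 (offDiagonal i j (j≢i ∘ sym)))))
    (cong (λ x → x ⁺ * s i) (diagonal i))

  Mx≡d⇒balanced : ∀ (x : Fin n → ℤ) (d : ℕ) → (∀ i → sumFinℤ (λ j → M i j *ℤ x j) ≡ + d) →
    Balanced (λ i j → M i j ⁻) d (λ j → x j ⁻) (λ j → x j ⁺)
  Mx≡d⇒balanced x d Mx≡d i = begin
    2 * x i ⁺ + sum (λ j → M i j ⁻ * x j ⁻)
      ≡⟨ cong (_+ sum (λ j → M i j ⁻ * x j ⁻)) (sum-⁺ i (λ j → x j ⁺)) ⟨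
    sum (λ j → M i j ⁺ * x j ⁺) + sum (λ j → M i j ⁻ * x j ⁻)
      ≡⟨ ∑-distrib-+ (λ j → M i j ⁺ * x j ⁺) (λ j → M i j ⁻ * x j ⁻) ⟨
    sum (λ j → M i j ⁺ * x j ⁺ + M i j ⁻ * x j ⁻)
      ≡⟨ split-⁺⁻-sum M x d i (Mx≡d i) ⟩
    d + sum (λ j → M i j ⁻ * x j ⁺ + M i j ⁺ * x j ⁻)
      ≡⟨ cong (_+_ d) (∑-distrib-+ (λ j → M i j ⁻ * x j ⁺) (λ j → M i j ⁺ * x j ⁻)) ⟩
    d + (sum (λ j → M i j ⁻ * x j ⁺) + sum (λ j → M i j ⁺ * x j ⁻))
      ≡⟨ cong (λ y → d + (sum (λ j → M i j ⁻ * x j ⁺) + y)) (sum-⁺ i (λ j → x j ⁻)) ⟩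
    d + (sum (λ j → M i j ⁻ * x j ⁺) + 2 * x i ⁻) ∎
    where open ≡-Reasoning

cartan-diagonal : ∀ {n} (Γ : Dynkin n) x → cartan Γ x x ≡ + 2
cartan-diagonal Γ x with Fin.toℕ x ≟ Fin.toℕ x
... | yes _   = refl
... | no  x≢x = contradiction refl x≢x

cartan-offDiagonal : ∀ {n} (Γ : Dynkin n) x y → x ≢ y → cartan Γ x y ≤ℤ + 0
cartan-offDiagonal Γ x y x≢y with Fin.toℕ x ≟ Fin.toℕ y
... | yes x≡y = contradiction (Fin.toℕ-injective x≡y) x≢y
... | no  _   = ℤ.neg-≤-pos

cartanRelabel-isCartanLike : ∀ {n} (Γ : Dynkin n) (σ : Permutation′ n) → IsCartanLike (cartanRelabel Γ σ)
cartanRelabel-isCartanLike Γ σ = record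
  { diagonal    = λ i → cartan-diagonal Γ (σ ⟨$⟩ʳ i)
  ; offDiagonal = λ i j i≢j → cartan-offDiagonal Γ (σ ⟨$⟩ʳ i) (σ ⟨$⟩ʳ j) (i≢j ∘ σ-injective)
  }
  where
  σ-injective : ∀ {i j} → σ ⟨$⟩ʳ i ≡ σ ⟨$⟩ʳ j → i ≡ j
  σ-injective {i} {j} σi≡σj = begin
    i                    ≡⟨ inverseˡ σ ⟨
    σ ⟨$⟩ˡ (σ ⟨$⟩ʳ i)    ≡⟨ cong (σ ⟨$⟩ˡ_) σi≡σj ⟩
    σ ⟨$⟩ˡ (σ ⟨$⟩ʳ j)    ≡⟨ inverseˡ σ ⟩
    j                    ∎
    where open ≡-Reasoning

module ExtremalIndex {n} (c : Fin n → Fin n → ℕ) (P : Fin n → ℕ) (2≤P : ∀ i → 2 ≤ P i) where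

  instance
    P-nonZero : ∀ {i} → NonZero (P i)
    P-nonZero {i} = >-nonZero (≤-trans (s≤s z≤n) (2≤P i))

  -- j ≼⟨ s ⟩ k says log (P j) / s j ≤ log (P k) / s k, cleared of denominators.
  _≼⟨_⟩_ : Fin n → (Fin n → ℕ) → Fin n → Set
  j ≼⟨ s ⟩ k = P j ^ s k ≤ P k ^ s j

  ≼-total : ∀ s → Total (_≼⟨ s ⟩_)
  ≼-total s j k = ≤-total (P j ^ s k) (P k ^ s j)

  ≼-trans : ∀ s → Transitive (_≼⟨ s ⟩_)
  ≼-trans s {j} {k} {l} j≼k k≼l with s k
  ... | zero   rewrite m^n≤1⇒n≡0 (s l) (2≤P k) k≼l = m^n>0 (P l) (s j)
  ... | suc sₖ = ^-cancelʳ-≤ (suc sₖ) (begin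
    (P j ^ s l) ^ suc sₖ  ≡⟨ [m^n]^o≡[m^o]^n (P j) (s l) (suc sₖ) ⟩
    (P j ^ suc sₖ) ^ s l  ≤⟨ ^-monoˡ-≤ (s l) j≼k ⟩
    (P k ^ s j) ^ s l     ≡⟨ [m^n]^o≡[m^o]^n (P k) (s j) (s l) ⟩
    (P k ^ s l) ^ s j     ≤⟨ ^-monoˡ-≤ (s j) k≼l ⟩
    (P l ^ suc sₖ) ^ s j  ≡⟨ [m^n]^o≡[m^o]^n (P l) (suc sₖ) (s j) ⟩
    (P l ^ s j) ^ suc sₖ  ∎)
    where open ≤-Reasoning

  neighbourProduct-^ : ∀ i t → neighbourProduct c P i ^ t ≡ prodFin (λ j → (P j ^ t) ^ c i j)
  neighbourProduct-^ i t = begin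
    neighbourProduct c P i ^ t          ≡⟨ prodFin-^ (λ j → P j ^ c i j) t ⟩
    prodFin (λ j → (P j ^ c i j) ^ t)   ≡⟨ prodFin-cong (λ j → [m^n]^o≡[m^o]^n (P j) (c i j) t) ⟩
    prodFin (λ j → (P j ^ t) ^ c i j)   ∎
    where open ≡-Reasoning

  ^-weightedSum : ∀ i s → P i ^ weightedSum c s i ≡ prodFin (λ j → (P i ^ s j) ^ c i j)
  ^-weightedSum i s = begin
    P i ^ weightedSum c s i              ≡⟨ ^-distribˡ-sum (P i) (λ j → c i j * s j) ⟩
    prodFin (λ j → P i ^ (c i j * s j))  ≡⟨ prodFin-cong (λ j → trans (cong (P i ^_) (*-comm (c i j) (s j)))
                                                                     (sym (^-*-assoc (P i) (s j) (c i j)))) ⟩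
    prodFin (λ j → (P i ^ s j) ^ c i j)  ∎
    where open ≡-Reasoning

  greatest⇒neighbourProduct^≤ : ∀ {i} s → (∀ j → j ≼⟨ s ⟩ i) →
    neighbourProduct c P i ^ s i ≤ P i ^ weightedSum c s i
  greatest⇒neighbourProduct^≤ {i} s j≼i = begin
    neighbourProduct c P i ^ s i          ≡⟨ neighbourProduct-^ i (s i) ⟩
    prodFin (λ j → (P j ^ s i) ^ c i j)   ≤⟨ prodFin-mono-≤ (λ j → ^-monoˡ-≤ (c i j) (j≼i j)) ⟩
    prodFin (λ j → (P i ^ s j) ^ c i j)   ≡⟨ ^-weightedSum i s ⟨
    P i ^ weightedSum c s i               ∎
    where open ≤-Reasoning

  least⇒^≤neighbourProduct : ∀ {i} s → (∀ j → i ≼⟨ s ⟩ j) →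
    P i ^ weightedSum c s i ≤ neighbourProduct c P i ^ s i
  least⇒^≤neighbourProduct {i} s i≼j = begin
    P i ^ weightedSum c s i               ≡⟨ ^-weightedSum i s ⟩
    prodFin (λ j → (P i ^ s j) ^ c i j)   ≤⟨ prodFin-mono-≤ (λ j → ^-monoˡ-≤ (c i j) (i≼j j)) ⟩
    prodFin (λ j → (P j ^ s i) ^ c i j)   ≡⟨ neighbourProduct-^ i (s i) ⟨
    neighbourProduct c P i ^ s i          ∎
    where open ≤-Reasoning

  module _ (d : ℕ) .{{_ : NonZero d}} where

    least⇒b≢0 : ∀ (a b : Fin n → ℕ) →
      (∀ i → neighbourProduct c P i ≤ P i ^ 2) →
      Balanced c d a b →
      ∀ {i} → (∀ j → i ≼⟨ a ⟩ j) → b i ≢ 0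
    least⇒b≢0 a b Π≤P² balance {i} i≼j bᵢ≡0 =
      ≢-nonZero⁻¹ d (m^n≤1⇒n≡0 d (2≤P i) (*-cancelʳ-≤ (P i ^ d) 1 (P i ^ (2 * a i)) {{m^n≢0 (P i) (2 * a i)}} (begin
        P i ^ d * P i ^ (2 * a i)       ≡⟨ ^-distribˡ-+-* (P i) d (2 * a i) ⟨
        P i ^ (d + 2 * a i)             ≤⟨ ^-monoʳ-≤ (P i) d+2aᵢ≤Σca ⟩
        P i ^ weightedSum c a i         ≤⟨ least⇒^≤neighbourProduct a i≼j ⟩
        neighbourProduct c P i ^ a i    ≤⟨ ^-monoˡ-≤ (a i) (Π≤P² i) ⟩
        (P i ^ 2) ^ a i                 ≡⟨ ^-*-assoc (P i) 2 (a i) ⟩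
        P i ^ (2 * a i)                 ≡⟨ *-identityˡ _ ⟨
        1 * P i ^ (2 * a i)             ∎)))
      where
      open ≤-Reasoning
      d+2aᵢ≤Σca : d + 2 * a i ≤ weightedSum c a i
      d+2aᵢ≤Σca = begin
        d + 2 * a i                          ≤⟨ +-monoʳ-≤ d (m≤n+m (2 * a i) (weightedSum c b i)) ⟩
        d + (weightedSum c b i + 2 * a i)    ≡⟨ balance i ⟨
        2 * b i + weightedSum c a i          ≡⟨ cong (λ x → 2 * x + weightedSum c a i) bᵢ≡0 ⟩
        weightedSum c a i                    ∎

    balanced⇒a≡0 : ∀ (a b : Fin n → ℕ) →
      (∀ i → neighbourProduct c P i ≤ P i ^ 2) →
      Balanced c d a b →
      (∀ i → a i ≡ 0 ⊎ b i ≡ 0) →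
      ∀ i → a i ≡ 0
    balanced⇒a≡0 a b Π≤P² balance disjoint i
      with ∃-greatest (flip (_≼⟨ a ⟩_)) (flip (≼-total a)) (flip (≼-trans a)) i
    ... | i₀ , i₀≼j with disjoint i₀
    ...   | inj₁ aᵢ₀≡0 = m^n≤1⇒n≡0 (a i) (2≤P i₀) (subst (λ x → P i₀ ^ a i ≤ P i ^ x) aᵢ₀≡0 (i₀≼j i))
    ...   | inj₂ bᵢ₀≡0 = contradiction bᵢ₀≡0 (least⇒b≢0 a b Π≤P² balance i₀≼j)

    module _ (Q : ℕ) (b : Fin n → ℕ) (P²≤QΠ : ∀ i → P i ^ 2 ≤ Q * neighbourProduct c P i)
             (balance : ∀ i → 2 * b i ≡ d + weightedSum c b i) where

      greatest⇒P^d≤Q^b : ∀ {i} → (∀ j → j ≼⟨ b ⟩ i) → P i ^ d ≤ Q ^ b i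
      greatest⇒P^d≤Q^b {i} j≼i = *-cancelʳ-≤ (P i ^ d) (Q ^ b i) (P i ^ weightedSum c b i) {{m^n≢0 (P i) (weightedSum c b i)}} (begin
        P i ^ d * P i ^ weightedSum c b i              ≡⟨ ^-distribˡ-+-* (P i) d _ ⟨
        P i ^ (d + weightedSum c b i)                  ≡⟨ cong (P i ^_) (balance i) ⟨
        P i ^ (2 * b i)                                ≡⟨ ^-*-assoc (P i) 2 (b i) ⟨
        (P i ^ 2) ^ b i                                ≤⟨ ^-monoˡ-≤ (b i) (P²≤QΠ i) ⟩
        (Q * neighbourProduct c P i) ^ b i             ≡⟨ ^-distribʳ-* Q _ (b i) ⟩
        Q ^ b i * neighbourProduct c P i ^ b i         ≤⟨ *-monoʳ-≤ (Q ^ b i) (greatest⇒neighbourProduct^≤ b j≼i) ⟩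
        Q ^ b i * P i ^ weightedSum c b i              ∎)
        where open ≤-Reasoning

      balanced⇒P^d≤Q^b : ∀ i → P i ^ d ≤ Q ^ b i
      balanced⇒P^d≤Q^b i with ∃-greatest (_≼⟨ b ⟩_) (≼-total b) (≼-trans b) i
      ... | i₀ , j≼i₀ = ^-cancelʳ-≤ (b i₀) {{bᵢ₀-nonZero}} (begin
        (P i ^ d) ^ b i₀      ≡⟨ [m^n]^o≡[m^o]^n (P i) d (b i₀) ⟩
        (P i ^ b i₀) ^ d      ≤⟨ ^-monoˡ-≤ d (j≼i₀ i) ⟩
        (P i₀ ^ b i) ^ d      ≡⟨ [m^n]^o≡[m^o]^n (P i₀) (b i) d ⟩
        (P i₀ ^ d) ^ b i      ≤⟨ ^-monoˡ-≤ (b i) (greatest⇒P^d≤Q^b j≼i₀) ⟩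
        (Q ^ b i₀) ^ b i      ≡⟨ [m^n]^o≡[m^o]^n Q (b i₀) (b i) ⟩
        (Q ^ b i) ^ b i₀      ∎)
        where
        open ≤-Reasoning
        bᵢ₀-nonZero : NonZero (b i₀)
        bᵢ₀-nonZero = ≢-nonZero λ bᵢ₀≡0 → ≢-nonZero⁻¹ d (m+n≡0⇒m≡0 d (trans (sym (balance i₀)) (cong (2 *_) bᵢ₀≡0)))

    balanced⇒bounded : ∀ (Q : ℕ) (a b : Fin n → ℕ) →
      (∀ i → neighbourProduct c P i ≤ P i ^ 2) →
      (∀ i → P i ^ 2 ≤ Q * neighbourProduct c P i) →
      Balanced c d a b →
      (∀ i → a i ≡ 0 ⊎ b i ≡ 0) →
      ∀ i → a i ≡ 0 × P i ^ d ≤ Q ^ b i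
    balanced⇒bounded Q a b Π≤P² P²≤QΠ balance disjoint i =
      a≡0 i , balanced⇒P^d≤Q^b Q b P²≤QΠ balance′ i
      where
      a≡0 : ∀ i → a i ≡ 0
      a≡0 = balanced⇒a≡0 a b Π≤P² balance disjoint
      balance′ : ∀ i → 2 * b i ≡ d + weightedSum c b i
      balance′ i = begin
        2 * b i                              ≡⟨ +-identityʳ (2 * b i) ⟨
        2 * b i + 0                          ≡⟨ cong (_+_ (2 * b i)) (weightedSum-vanishes c a≡0 i) ⟨
        2 * b i + weightedSum c a i          ≡⟨ balance i ⟩
        d + (weightedSum c b i + 2 * a i)    ≡⟨ cong (λ x → d + (weightedSum c b i + 2 * x)) (a≡0 i) ⟩
        d + (weightedSum c b i + 0)          ≡⟨ cong (_+_ d) (+-identityʳ (weightedSum c b i)) ⟩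
        d + weightedSum c b i                ∎
        where open ≡-Reasoning

k≡1+r+q*p : ∀ k p .{{_ : NonZero p}} → ∃[ r ] ∃[ q ] r < p × k ≡ + suc r +ℤ q *ℤ + p
k≡1+r+q*p k p = r , q , DivMod.n%ℕd<d (k - + 1) p , (begin
  k                           ≡⟨ shift k ⟩
  (k - + 1) +ℤ + 1            ≡⟨ cong (_+ℤ + 1) (DivMod.a≡a%ℕn+[a/ℕn]*n (k - + 1) p) ⟩
  + r +ℤ q *ℤ + p +ℤ + 1      ≡⟨ reorder (+ r) (q *ℤ + p) ⟩
  + 1 +ℤ + r +ℤ q *ℤ + p      ∎)
  where
  open ≡-Reasoning
  r = (k - + 1) DivMod.%ℕ p
  q = (k - + 1) DivMod./ℕ p
  shift : ∀ x → x ≡ x - + 1 +ℤ + 1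
  shift = solve-∀
  reorder : ∀ x y → x +ℤ y +ℤ + 1 ≡ + 1 +ℤ x +ℤ y
  reorder = solve-∀

module _ (G : ℤ → ℕ) (p : ℕ) .{{_ : NonZero p}} (periodic : ∀ k → G (k +ℤ + p) ≡ G k) where

  periodic-ℕ-multiple : ∀ N k → G (k +ℤ + (N * p)) ≡ G k
  periodic-ℕ-multiple zero    k = cong G (ℤ.+-identityʳ k)
  periodic-ℕ-multiple (suc N) k = begin
    G (k +ℤ + (p + N * p))           ≡⟨ cong (λ x → G (k +ℤ x)) (ℤ.pos-+ p (N * p)) ⟩
    G (k +ℤ (+ p +ℤ + (N * p)))      ≡⟨ cong G (swap k (+ p) (+ (N * p))) ⟩
    G (k +ℤ + (N * p) +ℤ + p)        ≡⟨ periodic _ ⟩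
    G (k +ℤ + (N * p))               ≡⟨ periodic-ℕ-multiple N k ⟩
    G k                              ∎
    where
    open ≡-Reasoning
    swap : ∀ x y z → x +ℤ (y +ℤ z) ≡ x +ℤ z +ℤ y
    swap = solve-∀

  periodic-ℤ-multiple : ∀ q k → G (k +ℤ q *ℤ + p) ≡ G k
  periodic-ℤ-multiple (+ N)     k = trans (cong (λ x → G (k +ℤ x)) (sym (ℤ.pos-* N p))) (periodic-ℕ-multiple N k)
  periodic-ℤ-multiple -[1+ N ]  k = begin
    G (k +ℤ -[1+ N ] *ℤ + p)                          ≡⟨ periodic-ℕ-multiple (suc N) _ ⟨
    G (k +ℤ -[1+ N ] *ℤ + p +ℤ + (suc N * p))         ≡⟨ cong (λ x → G (k +ℤ -[1+ N ] *ℤ + p +ℤ x)) (ℤ.pos-* (suc N) p) ⟩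
    G (k +ℤ -[1+ N ] *ℤ + p +ℤ + suc N *ℤ + p)        ≡⟨ cong G (cancel k (+ suc N) (+ p)) ⟩
    G k                                               ∎
    where
    open ≡-Reasoning
    cancel : ∀ x y z → x +ℤ - y *ℤ z +ℤ y *ℤ z ≡ x
    cancel = solve-∀

  periodic≤prodUpTo : (∀ k → NonZero (G k)) → ∀ k → G k ≤ prodUpTo p (λ k → G (+ k))
  periodic≤prodUpTo nonZero k with k≡1+r+q*p k p
  ... | r , q , r<p , refl = begin
    G (+ suc r +ℤ q *ℤ + p)    ≡⟨ periodic-ℤ-multiple q (+ suc r) ⟩
    G (+ suc r)                ≤⟨ factor≤prodUpTo (λ k → G (+ k)) (λ k → nonZero (+ k)) r<p ⟩
    prodUpTo p (λ k → G (+ k)) ∎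
    where open ≤-Reasoning

module PeriodicFrieze {n} {M : Fin n → Fin n → ℤ} (cartanLike : IsCartanLike M)
  {F : Fin n → ℤ → ℕ} (frieze : IsPositiveIntegralFrieze M F)
  (p : ℕ) .{{_ : NonZero p}} (periodic : ∀ i k → F i (k +ℤ + p) ≡ F i k) where

  open IsPositiveIntegralFrieze frieze
  open IsCartanLike cartanLike

  instance
    F-nonZero : ∀ {i k} → NonZero (F i k)
    F-nonZero {i} {k} = >-nonZero (positive i k)

  -- The factors in MeshAt are local to its where-block; a proof of MeshAt exposes them in its type.
  meshLowerFactors meshUpperFactors : ∀ {A} {g h : Fin n → ℕ} → A ≡ 1 + prodFin g * prodFin h → Fin n → ℕ
  meshLowerFactors {g = g} _ = g
  meshUpperFactors {h = h} _ = h

  P : Fin n → ℕ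
  P i = prodUpTo p (λ k → F i (+ k))

  c : Fin n → Fin n → ℕ
  c i j = M i j ⁻

  meshProduct : Fin n → ℤ → ℕ
  meshProduct i k = prodFin (meshLowerFactors (mesh i k)) * prodFin (meshUpperFactors (mesh i k))

  meshProduct-nonZero : ∀ i k → NonZero (meshProduct i k)
  meshProduct-nonZero i k =
    m*n≢0 _ _ {{prodFin-nonZero _ lower-nonZero}} {{prodFin-nonZero _ upper-nonZero}}
    where
    lower-nonZero : ∀ j → NonZero (meshLowerFactors (mesh i k) j)
    lower-nonZero j with j Fin.<? i
    ... | yes _ = m^n≢0 (F j k) ∣ M i j ∣
    ... | no  _ = _
    upper-nonZero : ∀ j → NonZero (meshUpperFactors (mesh i k) j)
    upper-nonZero j with i Fin.<? j
    ... | yes _ = m^n≢0 (F j (k +ℤ + 1)) ∣ M i j ∣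
    ... | no  _ = _

  P-shift : ∀ j → prodUpTo p (λ k → F j (+ k +ℤ + 1)) ≡ P j
  P-shift j = trans (prodUpTo-cong p (λ k → cong (λ m → F j (+ m)) (+-comm k 1)))
                    (prodUpTo-rotate p (λ k → F j (+ k)) (periodic j (+ 1)))

  factors-over-period : ∀ i j →
    prodUpTo p (λ k → meshLowerFactors (mesh i (+ k)) j) *
    prodUpTo p (λ k → meshUpperFactors (mesh i (+ k)) j) ≡ P j ^ c i j
  factors-over-period i j with j Fin.<? i | i Fin.<? j
  ... | yes j<i | yes i<j = contradiction i<j (Fin.<-asym j<i)
  ... | yes j<i | no  _   = begin
    prodUpTo p (λ k → F j (+ k) ^ ∣ M i j ∣) * prodUpTo p (λ _ → 1)
      ≡⟨ cong₂ _*_ (prodUpTo-^ p (λ k → F j (+ k)) ∣ M i j ∣) (prodUpTo-1 p) ⟩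
    P j ^ ∣ M i j ∣ * 1      ≡⟨ *-identityʳ _ ⟩
    P j ^ ∣ M i j ∣          ≡⟨ cong (P j ^_) (⁻-offDiagonal i j (λ i≡j → Fin.<-irrefl (sym i≡j) j<i)) ⟨
    P j ^ c i j              ∎
    where open ≡-Reasoning
  ... | no  _   | yes i<j = begin
    prodUpTo p (λ _ → 1) * prodUpTo p (λ k → F j (+ k +ℤ + 1) ^ ∣ M i j ∣)
      ≡⟨ cong₂ _*_ (prodUpTo-1 p) (prodUpTo-^ p (λ k → F j (+ k +ℤ + 1)) ∣ M i j ∣) ⟩
    1 * prodUpTo p (λ k → F j (+ k +ℤ + 1)) ^ ∣ M i j ∣
      ≡⟨ *-identityˡ _ ⟩
    prodUpTo p (λ k → F j (+ k +ℤ + 1)) ^ ∣ M i j ∣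
      ≡⟨ cong (_^ ∣ M i j ∣) (P-shift j) ⟩
    P j ^ ∣ M i j ∣          ≡⟨ cong (P j ^_) (⁻-offDiagonal i j (λ i≡j → Fin.<-irrefl i≡j i<j)) ⟨
    P j ^ c i j              ∎
    where open ≡-Reasoning
  ... | no  j≮i | no  i≮j = begin
    prodUpTo p (λ _ → 1) * prodUpTo p (λ _ → 1)  ≡⟨ cong₂ _*_ (prodUpTo-1 p) (prodUpTo-1 p) ⟩
    1                                            ≡⟨ cong (λ x → P j ^ x) (trans (cong (c i) j≡i) (⁻-diagonal i)) ⟨
    P j ^ c i j                                  ∎
    where
    open ≡-Reasoning
    j≡i : j ≡ i
    j≡i = Fin.≤-antisym (≮⇒≥ i≮j) (≮⇒≥ j≮i)

  meshProduct-over-period : ∀ i → prodUpTo p (λ k → meshProduct i (+ k)) ≡ neighbourProduct c P i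
  meshProduct-over-period i = begin
    prodUpTo p (λ k → prodFin (lower k) * prodFin (upper k))
      ≡⟨ prodUpTo-distrib-* p (λ k → prodFin (lower k)) (λ k → prodFin (upper k)) ⟩
    prodUpTo p (λ k → prodFin (lower k)) * prodUpTo p (λ k → prodFin (upper k))
      ≡⟨ cong₂ _*_ (prodUpTo-prodFin p (λ j k → lower k j)) (prodUpTo-prodFin p (λ j k → upper k j)) ⟩
    prodFin (λ j → prodUpTo p (λ k → lower k j)) * prodFin (λ j → prodUpTo p (λ k → upper k j))
      ≡⟨ prodFin-distrib-* (λ j → prodUpTo p (λ k → lower k j)) (λ j → prodUpTo p (λ k → upper k j)) ⟨
    prodFin (λ j → prodUpTo p (λ k → lower k j) * prodUpTo p (λ k → upper k j))
      ≡⟨ prodFin-cong (factors-over-period i) ⟩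
    neighbourProduct c P i ∎
    where
    open ≡-Reasoning
    lower upper : ℕ → Fin n → ℕ
    lower k = meshLowerFactors (mesh i (+ k))
    upper k = meshUpperFactors (mesh i (+ k))

  P²-over-period : ∀ i → P i ^ 2 ≡ prodUpTo p (λ k → 1 + meshProduct i (+ k))
  P²-over-period i = begin
    P i * (P i * 1)                                   ≡⟨ cong (P i *_) (*-identityʳ (P i)) ⟩
    P i * P i                                         ≡⟨ cong (P i *_) (P-shift i) ⟨
    P i * prodUpTo p (λ k → F i (+ k +ℤ + 1))         ≡⟨ prodUpTo-distrib-* p (λ k → F i (+ k)) _ ⟨
    prodUpTo p (λ k → F i (+ k) * F i (+ k +ℤ + 1))   ≡⟨ prodUpTo-cong p (λ k → mesh i (+ k)) ⟩
    prodUpTo p (λ k → 1 + meshProduct i (+ k))        ∎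
    where open ≡-Reasoning

  neighbourProduct≤P² : ∀ i → neighbourProduct c P i ≤ P i ^ 2
  neighbourProduct≤P² i = begin
    neighbourProduct c P i                      ≡⟨ meshProduct-over-period i ⟨
    prodUpTo p (λ k → meshProduct i (+ k))      ≤⟨ prodUpTo-mono-≤ p (λ k → n≤1+n _) ⟩
    prodUpTo p (λ k → 1 + meshProduct i (+ k))  ≡⟨ P²-over-period i ⟨
    P i ^ 2                                     ∎
    where open ≤-Reasoning

  P²≤2^p*neighbourProduct : ∀ i → P i ^ 2 ≤ 2 ^ p * neighbourProduct c P i
  P²≤2^p*neighbourProduct i = begin
    P i ^ 2                                            ≡⟨ P²-over-period i ⟩
    prodUpTo p (λ k → 1 + meshProduct i (+ k))         ≤⟨ prodUpTo-mono-≤ p (λ k →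
                                                            1+m≤2*m _ {{meshProduct-nonZero i (+ k)}}) ⟩
    prodUpTo p (λ k → 2 * meshProduct i (+ k))         ≡⟨ prodUpTo-distrib-* p (λ _ → 2) _ ⟩
    prodUpTo p (λ _ → 2) * prodUpTo p (λ k → meshProduct i (+ k))
                                                       ≡⟨ cong₂ _*_ (prodUpTo-const p 2) (meshProduct-over-period i) ⟩
    2 ^ p * neighbourProduct c P i                     ∎
    where open ≤-Reasoning

  2≤P : ∀ i → 2 ≤ P i
  2≤P i = ≰⇒> (λ Pᵢ≤1 → <⇒≱ 2≤P² (^-monoˡ-≤ 2 Pᵢ≤1))
    where
    open ≤-Reasoning
    2≤P² : 2 ≤ P i ^ 2
    2≤P² = begin
      2                                            ≤⟨ ^-monoʳ-≤ 2 (>-nonZero⁻¹ p) ⟩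
      2 ^ p                                        ≡⟨ prodUpTo-const p 2 ⟨
      prodUpTo p (λ _ → 2)                         ≤⟨ prodUpTo-mono-≤ p (λ k →
                                                        s≤s (>-nonZero⁻¹ _ {{meshProduct-nonZero i (+ k)}})) ⟩
      prodUpTo p (λ k → 1 + meshProduct i (+ k))   ≡⟨ P²-over-period i ⟨
      P i ^ 2                                      ∎

mainTheorem2 : ∀ {n} (Γ : Dynkin n) (σ : Permutation′ n)
    (F : Fin n → ℤ → ℕ) →
    IsPositiveIntegralFrieze (cartanRelabel Γ σ) F →
    (p : ℕ) → .{{_ : NonZero p}} →
    (∀ i k → F i (k +ℤ + p) ≡ F i k) →
    -- b = Bv / d is the vector of row sums of C⁻¹, i.e. C b = (1,…,1)
    (Bv : Fin n → ℤ) (d : ℕ) → .{{_ : NonZero d}} →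
    (∀ i → sumFinℤ (λ j → cartanRelabel Γ σ i j *ℤ Bv j) ≡ + d) →
    ∀ i →
      (+ 0 ≤ℤ Bv i)
      -- a_i(F) ≤ b_i  ⇔  (∏_{k=1}^p F i k)^d ≤ 2^(p * Bv i)
      × (prodUpTo p (λ k → F i (+ k)) ^ d ≤ 2 ^ (p * ∣ Bv i ∣))
      -- F i k ≤ 2^(p b_i)  ⇔  (F i k)^d ≤ 2^(p * Bv i)
      × (∀ k → F i k ^ d ≤ 2 ^ (p * ∣ Bv i ∣))
mainTheorem2 Γ σ F frieze p periodic Bv d CBv≡d i =
  subst (+ 0 ≤ℤ_) (sym Bvᵢ≡+Bvᵢ⁺) (+≤+ z≤n) ,
  Pᵢ^d≤ ,
  λ k → ≤-trans (^-monoˡ-≤ d (periodic≤prodUpTo (F i) p (periodic i) (λ _ → F-nonZero) k)) Pᵢ^d≤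
  where
  cartanLike : IsCartanLike (cartanRelabel Γ σ)
  cartanLike = cartanRelabel-isCartanLike Γ σ
  open PeriodicFrieze cartanLike frieze p periodic
  open ExtremalIndex c P 2≤P
  bounds : Bv i ⁻ ≡ 0 × P i ^ d ≤ (2 ^ p) ^ Bv i ⁺
  bounds = balanced⇒bounded d (2 ^ p) (λ j → Bv j ⁻) (λ j → Bv j ⁺)
    neighbourProduct≤P² P²≤2^p*neighbourProduct
    (IsCartanLike.Mx≡d⇒balanced cartanLike Bv d CBv≡d) (λ j → ⁻≡0⊎⁺≡0 (Bv j)) i
  Bvᵢ≡+Bvᵢ⁺ : Bv i ≡ + Bv i ⁺
  Bvᵢ≡+Bvᵢ⁺ = ⁻≡0⇒x≡+x⁺ (Bv i) (proj₁ bounds)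
  Pᵢ^d≤ : P i ^ d ≤ 2 ^ (p * ∣ Bv i ∣)
  Pᵢ^d≤ = subst (P i ^ d ≤_) (trans (^-*-assoc 2 p _) (cong (λ x → 2 ^ (p * ∣ x ∣)) (sym Bvᵢ≡+Bvᵢ⁺))) (proj₂ bounds)
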